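{- For every integer $t \ge 3$, $\mathrm{ex}_2(K_n, \{K_{1,t}\}) = \Theta(n)$ for all sufficiently large $n$.
   Context: A $2$-edge-coloring of $K_n$ is a partition $E(K_n)=E(R)\cup E(B)$ into red and blue edges. The coloring contains an induced monochromatic copy of a graph $H$ if there is $U\subseteq V(K_n)$ with $|U|=|V(H)|$ such that the red edges inside $U$, or the blue edges inside $U$, form a graph isomorphic to $H$. For a family $\mathcal{F}$ of graphs containing no complete or empty graphs, $\mathrm{ex}_2(K_n,\mathcal{F})$ is the least integer $m$ such that every $2$-edge-coloring of $K_n$ with more than $m$ edges in each color contains an induced monochromatic member of $\mathcal{F}$ (equivalently, the largest $m\le \frac12\binom n2$ such that some coloring with exactly $m$ edges in its smaller color class has no induced monochromatic member of $\mathcal{F}$); it is $\infty$ if no such bound exists. $K_{1,t}$ is the star with $t$ leaves. Asymptotics are as $n\to\infty$ with constants depending on $t$. -}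

module Defs where

open import Data.Nat using (ℕ; zero; suc; _+_; _*_; _<_; _<ᵇ_)
open import Data.Bool using (Bool; true; false; not; _∧_; if_then_else_)
open import Data.Fin using (Fin; toℕ)
open import Data.List using (List; map; allFin)
open import Data.Nat.ListAction using (sum)
open import Data.Product using (Σ; _×_; ∃)
open import Data.Sum using (_⊎_)
open import Relation.Nullary using (¬_)
open import Relation.Binary.PropositionalEquality using (_≡_; _≢_)
open import Function.Definitions using (Injective)

-- A 2-edge-colouring of K_n: colour of edge {i,j} (i ≠ j); true = red, false = blue.
-- The colour of an edge does not depend on the order of its endpoints.
record Coloring (n : ℕ) : Set where
  field
    col : Fin n → Fin n → Bool
    sym : ∀ i j → col i j ≡ col j i
open Coloring public

countColor : ∀ {n} → Coloring n → Bool → ℕ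
countColor {n} c b =
  sum (map (λ i → sum (map (λ j →
      if (toℕ i <ᵇ toℕ j) ∧ isB (col c i j) then 1 else 0) (allFin n))) (allFin n))
  where
    isB : Bool → Bool
    isB x = if b then x else not x

redCount blueCount : ∀ {n} → Coloring n → ℕ
redCount c = countColor c true
blueCount c = countColor c false

-- The edges of colour b inside U = {v} ∪ f(Fin t) form a graph isomorphic to K_{1,t}
-- (center v, leaves f k): written out, all center–leaf edges have colour b and all
-- leaf–leaf edges have the other colour.
InducedStarIn : ∀ {n} → (t : ℕ) → Coloring n → Bool → Set
InducedStarIn {n} t c b =
  Σ (Fin n) λ v → Σ (Fin t → Fin n) λ f →
    Injective _≡_ _≡_ f × (∀ k → f k ≢ v) ×
    (∀ k → col c v (f k) ≡ b) ×
    (∀ k l → k ≢ l → col c (f k) (f l) ≡ not b)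

HasInducedMonoStar : ∀ {n} → ℕ → Coloring n → Set
HasInducedMonoStar t c = InducedStarIn t c true ⊎ InducedStarIn t c false

Forces : ℕ → ℕ → ℕ → Set
Forces t n m = ∀ (c : Coloring n) → m < redCount c → m < blueCount c →
  HasInducedMonoStar t c

-- ex₂(K_n, {K_{1,t}}) = m : m is the least integer with the property `Forces`
-- (it is ∞ iff no such m exists).
IsEx2Star : ℕ → ℕ → ℕ → Set
IsEx2Star t n m = Forces t n m × (∀ m' → m' < m → ¬ Forces t n m')

{-# OPTIONS --safe #-}

-- In a colouring without an induced monochromatic K_{1,t}, some colour has
-- bounded maximum degree.  If a vertex v has red degree at least R(t²+1, t),
-- Ramsey's theorem in its red neighbourhood gives a red clique Q of size t²+1
-- (a blue t-clique there would be a red star centred at v).  Each vertex is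
-- non-red to at most t vertices of Q, for otherwise it centres a blue star; so
-- against any blue t-clique some vertex of Q is red to all of it, a red star.
-- Hence there is no blue t-clique, and by Ramsey again every blue degree is
-- below R(t, t).  One colour thus has at most C n edges, so every colouring with
-- more than C n edges of each colour contains the star.  Conversely, the path
-- P_n and its complement contain no induced monochromatic K_{1,3} and each has
-- at least n - 2 edges.  Forcing is decidable by exhaustive search, so ex₂ is the
-- least forcing m, and it lies between n - 2 and C n.

module Submission where

open import Defs
open import Data.Bool using (Bool; true; false; not; T; _∧_; if_then_else_)
open import Data.Bool.Properties using (∨-comm; ¬-not; T-∧) renaming (_≟_ to _≟ᵇ_)
open import Data.Empty using (⊥; ⊥-elim)
open import Data.Fin using (Fin; zero; suc; toℕ; fromℕ<; inject≤; #_) renaming (_≟_ to _≟ᶠ_)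
open import Data.Fin.Properties using (any?; all?; ∀-cons; inject≤-injective; toℕ-fromℕ<; toℕ-injective)
open import Data.List using (List; []; _∷_; length; filter; lookup; map; tabulate; allFin)
open import Data.List.Membership.Propositional using (_∈_; _∉_)
open import Data.List.Membership.Propositional.Properties using (∈-filter⁻; ∈-lookup; ∈-allFin)
open import Data.List.Properties using (map-cong; map-tabulate; length-tabulate)
open import Data.List.Relation.Binary.Sublist.Propositional.Properties as Sublist
  using (filter-⊆; length-mono-≤)
open import Data.List.Relation.Unary.All as All using ()
open import Data.List.Relation.Unary.Any using (here; there)
open import Data.List.Relation.Unary.Unique.Propositional using (Unique; _∷_)
open import Data.List.Relation.Unary.Unique.Propositional.Properties using (filter⁺; allFin⁺; Unique[x∷xs]⇒x∉xs)
open import Data.Nat using (ℕ; zero; suc; _+_; _*_; _<_; _≤_; _≥_; _>_; _<ᵇ_; z≤n; s≤s) renaming (_≟_ to _≟ⁿ_)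
open import Data.Nat.ListAction using (sum)
open import Data.Nat.Properties
  using (_<?_; _≤?_; ≤-refl; ≤-trans; ≤-reflexive; <-≤-trans; <⇒≤; ≰⇒>; ≮⇒≥; n≮n; <⇒≢; <ᵇ⇒<; <⇒<ᵇ;
         +-comm; *-comm; +-suc; +-mono-≤; +-monoˡ-≤; +-monoʳ-<; *-monoʳ-≤; +-cancelˡ-≤; +-cancelˡ-<;
         m≤m+n; m≤n+m; m≤n⇒m≤1+n; n<1+n; m<n+m)
open import Data.Product using (Σ; ∃; _×_; _,_; proj₁; proj₂; map₂)
open import Data.Sum using (_⊎_; inj₁; inj₂; [_,_]′) renaming (map to ⊎-map)
open import Data.Unit using (tt)
open import Data.Vec.Functional using (Vector; head; tail) renaming (_∷_ to _∷ᵛ_)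
open import Data.Vec.Functional.Relation.Binary.Pointwise using (Pointwise)
open import Function using (_∘_; id)
open import Function.Bundles using (Equivalence)
open import Function.Definitions using (Injective)
open import Level using (0ℓ)
open import Relation.Binary.Core using (Rel)
open import Relation.Binary.Definitions using (Reflexive; _Respects_)
open import Relation.Binary.PropositionalEquality using (_≡_; _≢_; refl; trans; subst; subst₂; cong)
import Relation.Binary.PropositionalEquality as ≡
open import Relation.Nullary using (Dec; yes; no; ¬_; ¬?; does; proof; contradiction)
open import Relation.Nullary.Decidable using (map′; _×-dec_; _⊎-dec_; _→-dec_; dec-true; dec-false)
open import Relation.Nullary.Reflects using (Reflects; invert)
open import Relation.Unary using (Pred; Decidable)
open import Relation.Unary.Properties using (∁?)

-- Without function extensionality, vectors can only be searched up to pointwise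
-- equality, hence the invariance hypothesis.
Searchable : (A : Set) → Rel A 0ℓ → Set₁
Searchable A _≈_ = ∀ (P : Pred A 0ℓ) → P Respects _≈_ → Decidable P → Dec (∃ P)

Fin-searchable : ∀ n → Searchable (Fin n) _≡_
Fin-searchable n P _ P? = any? P?

Bool-searchable : Searchable Bool _≡_
Bool-searchable P _ P? =
  map′ [ (true ,_) , (false ,_) ]′ (λ { (true , p) → inj₁ p ; (false , p) → inj₂ p })
       (P? true ⊎-dec P? false)

Vector-searchable : ∀ {A : Set} {_≈_ : Rel A 0ℓ} → Reflexive _≈_ →
  Searchable A _≈_ → ∀ k → Searchable (Vector A k) (Pointwise _≈_)
Vector-searchable refl≈ search zero P resp P? =
  map′ (λ p → _ , p) (λ (f , p) → resp (λ ()) p) (P? (λ ()))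
Vector-searchable {A} {_≈_} refl≈ search (suc k) P resp P? =
  map′ (λ (a , g , p) → a ∷ᵛ g , p)
       (λ (f , p) → head f , tail f , resp (λ { zero → refl≈ ; (suc i) → refl≈ }) p)
       (search Extends extends-resp extends?)
  where
    Extends : Pred A 0ℓ
    Extends a = ∃ λ g → P (a ∷ᵛ g)
    extends-resp : Extends Respects _≈_
    extends-resp a≈b (g , p) = g , resp (λ { zero → a≈b ; (suc i) → refl≈ }) p
    extends? : Decidable Extends
    extends? a = Vector-searchable refl≈ search k (λ g → P (a ∷ᵛ g))
      (λ g≈h → resp (λ { zero → refl≈ ; (suc i) → g≈h i })) (λ g → P? (a ∷ᵛ g))

injective? : ∀ {k n} (f : Fin k → Fin n) → Dec (Injective _≡_ _≡_ f)
injective? f = map′ (λ inj {x} {y} → inj x y) (λ inj x y → inj)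
  (all? λ x → all? λ y → (f x ≟ᶠ f y) →-dec (x ≟ᶠ y))

StarAt : ∀ {n} t → Coloring n → Bool → Fin n → (Fin t → Fin n) → Set
StarAt t c b v f = Injective _≡_ _≡_ f × (∀ k → f k ≢ v) ×
  (∀ k → col c v (f k) ≡ b) × (∀ k l → k ≢ l → col c (f k) (f l) ≡ not b)

starAt? : ∀ {n} t c b v (f : Fin t → Fin n) → Dec (StarAt t c b v f)
starAt? t c b v f = injective? f ×-dec all? (λ k → ¬? (f k ≟ᶠ v)) ×-dec
  all? (λ k → col c v (f k) ≟ᵇ b) ×-dec
  all? (λ k → all? λ l → ¬? (k ≟ᶠ l) →-dec (col c (f k) (f l) ≟ᵇ not b))

starAt-resp : ∀ {n} t c b v → StarAt {n} t c b v Respects Pointwise _≡_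
starAt-resp t c b v f≗g (inj , ≢v , centre , leaves) =
  (λ {k} {l} e → inj (trans (f≗g k) (trans e (≡.sym (f≗g l))))) ,
  (λ k e → ≢v k (trans (f≗g k) e)) ,
  (λ k → subst (λ w → col c v w ≡ b) (f≗g k) (centre k)) ,
  (λ k l k≢l → subst₂ (λ w z → col c w z ≡ not b) (f≗g k) (f≗g l) (leaves k l k≢l))

inducedStarIn? : ∀ {n} t c b → Dec (InducedStarIn {n} t c b)
inducedStarIn? {n} t c b = any? λ v →
  Vector-searchable refl (Fin-searchable n) t _ (starAt-resp t c b v) (starAt? t c b v)

hasInducedMonoStar? : ∀ {n} t (c : Coloring n) → Dec (HasInducedMonoStar t c)
hasInducedMonoStar? t c = inducedStarIn? t c true ⊎-dec inducedStarIn? t c false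

_≈ᶜ_ : ∀ {n} → Rel (Coloring n) 0ℓ
c ≈ᶜ c′ = ∀ i j → col c i j ≡ col c′ i j

countColor-cong : ∀ {n} (c c′ : Coloring n) b → c ≈ᶜ c′ → countColor c b ≡ countColor c′ b
countColor-cong {n} c c′ b c≈c′ = cong sum (map-cong (λ i → cong sum (map-cong (λ j →
  cong (λ x → if (toℕ i <ᵇ toℕ j) ∧ (if b then x else not x) then 1 else 0) (c≈c′ i j))
  (allFin n))) (allFin n))

hasInducedMonoStar-cong : ∀ {n} t (c c′ : Coloring n) → c ≈ᶜ c′ →
  HasInducedMonoStar t c → HasInducedMonoStar t c′
hasInducedMonoStar-cong t c c′ c≈c′ = ⊎-map transport transport
  where
    transport : ∀ {b} → InducedStarIn t c b → InducedStarIn t c′ b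
    transport (v , f , inj , ≢v , centre , leaves) = v , f , inj , ≢v ,
      (λ k → trans (≡.sym (c≈c′ v (f k))) (centre k)) ,
      (λ k l k≢l → trans (≡.sym (c≈c′ (f k) (f l))) (leaves k l k≢l))

Counterexample : ∀ t {n} → ℕ → Coloring n → Set
Counterexample t m c = m < redCount c × m < blueCount c × ¬ HasInducedMonoStar t c

counterexample-cong : ∀ t {n} m (c c′ : Coloring n) → c ≈ᶜ c′ →
  Counterexample t m c → Counterexample t m c′
counterexample-cong t m c c′ c≈c′ (r , b , ¬star) =
  subst (m <_) (countColor-cong c c′ true c≈c′) r ,
  subst (m <_) (countColor-cong c c′ false c≈c′) b ,
  λ star → ¬star (hasInducedMonoStar-cong t c′ c (λ i j → ≡.sym (c≈c′ i j)) star)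

counterexample? : ∀ t {n} m (c : Coloring n) → Dec (Counterexample t m c)
counterexample? t m c = m <? redCount c ×-dec m <? blueCount c ×-dec ¬? (hasInducedMonoStar? t c)

toColoring : ∀ {n} (χ : Fin n → Fin n → Bool) → (∀ i j → χ i j ≡ χ j i) → Coloring n
toColoring χ s = record { col = χ ; sym = s }

RawCounterexample : ∀ t n → ℕ → Pred (Vector (Vector Bool n) n) 0ℓ
RawCounterexample t n m χ = Σ (∀ i j → χ i j ≡ χ j i) λ s → Counterexample t m (toColoring χ s)

rawCounterexample-resp : ∀ t n m → RawCounterexample t n m Respects Pointwise (Pointwise _≡_)
rawCounterexample-resp t n m {χ} {ψ} χ≗ψ (s , ce) =
  s′ , counterexample-cong t m (toColoring χ s) (toColoring ψ s′) χ≗ψ ce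
  where
    s′ : ∀ i j → ψ i j ≡ ψ j i
    s′ i j = trans (≡.sym (χ≗ψ i j)) (trans (s i j) (χ≗ψ j i))

rawCounterexample? : ∀ t n m → Decidable (RawCounterexample t n m)
rawCounterexample? t n m χ with all? (λ i → all? λ j → χ i j ≟ᵇ χ j i)
... | no ¬s = no λ (s , _) → ¬s s
... | yes s = map′ (s ,_)
  (λ (s′ , ce) → counterexample-cong t m (toColoring χ s′) (toColoring χ s) (λ _ _ → refl) ce)
  (counterexample? t m (toColoring χ s))

forces? : ∀ t n m → Dec (Forces t n m)
forces? t n m = map′ noCounterexample⇒forces forces⇒noCounterexample
  (¬? (Vector-searchable (λ _ → refl) (Vector-searchable refl Bool-searchable n) n
         (RawCounterexample t n m) (rawCounterexample-resp t n m) (rawCounterexample? t n m)))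
  where
    noCounterexample⇒forces : ¬ ∃ (RawCounterexample t n m) → Forces t n m
    noCounterexample⇒forces ¬ce c r b with hasInducedMonoStar? t c
    ... | yes star = star
    ... | no ¬star = ⊥-elim (¬ce (col c , Coloring.sym c , r , b , ¬star))
    forces⇒noCounterexample : Forces t n m → ¬ ∃ (RawCounterexample t n m)
    forces⇒noCounterexample forces (χ , s , r , b , ¬star) = ¬star (forces (toColoring χ s) r b)

least-witness : (P : Pred ℕ 0ℓ) → Decidable P → ∀ {k} → P k →
  ∃ λ m → P m × (∀ m′ → m′ < m → ¬ P m′) × m ≤ k
least-witness P P? {k} Pk with P? 0
... | yes P0 = 0 , P0 , (λ _ ()) , z≤n
least-witness P P? {zero} P0 | no ¬P0 = contradiction P0 ¬P0
least-witness P P? {suc k} Pk | no ¬P0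
  with m , Pm , below , m≤k ← least-witness (P ∘ suc) (P? ∘ suc) Pk =
  suc m , Pm , (λ { zero _ → ¬P0 ; (suc m′) (s≤s m′<m) → below m′ m′<m }) , s≤s m≤k

module _ {A : Set} {P : Pred A 0ℓ} (P? : Decidable P) where

  length-filter-∁ : ∀ xs → length (filter P? xs) + length (filter (∁? P?) xs) ≡ length xs
  length-filter-∁ [] = refl
  length-filter-∁ (x ∷ xs) with P? x
  ... | yes _ = cong suc (length-filter-∁ xs)
  ... | no _ = trans (+-suc _ _) (cong suc (length-filter-∁ xs))

  length-filter-filter : ∀ {Q : Pred A 0ℓ} (Q? : Decidable Q) xs →
    length (filter Q? (filter P? xs)) ≤ length (filter Q? xs)
  length-filter-filter Q? xs =
    length-mono-≤ (Sublist.filter⁺ Q? Q? (λ { refl q → q }) (filter-⊆ P? xs))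

pigeonhole-avoid : ∀ {A : Set} k {B} (Bad : Fin k → Pred A 0ℓ) (Bad? : ∀ i → Decidable (Bad i)) xs →
  (∀ i → length (filter (Bad? i) xs) ≤ B) → k * B < length xs →
  ∃ λ x → x ∈ xs × ∀ i → ¬ Bad i x
pigeonhole-avoid zero Bad Bad? (x ∷ xs) _ _ = x , here refl , λ ()
pigeonhole-avoid (suc k) {B} Bad Bad? xs few many
  with pigeonhole-avoid k (Bad ∘ suc) (Bad? ∘ suc) (filter (∁? (Bad? zero)) xs) few′ many′
  where
    few′ : ∀ i → length (filter (Bad? (suc i)) (filter (∁? (Bad? zero)) xs)) ≤ B
    few′ i = ≤-trans (length-filter-filter (∁? (Bad? zero)) (Bad? (suc i)) xs) (few (suc i))
    many′ : k * B < length (filter (∁? (Bad? zero)) xs)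
    many′ = +-cancelˡ-< B _ _ (<-≤-trans many (≤-trans
      (≤-reflexive (≡.sym (length-filter-∁ (Bad? zero) xs))) (+-monoˡ-≤ _ (few zero))))
... | x , x∈ , good with x∈xs , ¬bad₀ ← ∈-filter⁻ (∁? (Bad? zero)) {xs = xs} x∈ =
  x , x∈xs , ∀-cons ¬bad₀ good

module _ {A : Set} where

  lookup-injective : ∀ {xs : List A} → Unique xs → Injective _≡_ _≡_ (lookup xs)
  lookup-injective (_ ∷ _) {zero} {zero} _ = refl
  lookup-injective (x≢xs ∷ _) {zero} {suc j} e = contradiction e (All.lookup x≢xs (∈-lookup j))
  lookup-injective (x≢xs ∷ _) {suc i} {zero} e = contradiction (≡.sym e) (All.lookup x≢xs (∈-lookup i))
  lookup-injective (_ ∷ u) {suc i} {suc j} e = cong suc (lookup-injective u e)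

  select : ∀ {t} {xs : List A} → Unique xs → t ≤ length xs →
    Σ (Fin t → A) λ f → Injective _≡_ _≡_ f × ∀ i → f i ∈ xs
  select {xs = xs} u t≤ = (λ i → lookup xs (inject≤ i t≤)) ,
    (λ e → inject≤-injective t≤ t≤ _ _ (lookup-injective u e)) , λ i → ∈-lookup (inject≤ i t≤)

  length≤1 : ∀ {xs : List A} {z} → Unique xs → (∀ {y} → y ∈ xs → y ≡ z) → length xs ≤ 1
  length≤1 {[]} _ _ = z≤n
  length≤1 {_ ∷ []} _ _ = s≤s z≤n
  length≤1 {_ ∷ _ ∷ _} ((x≢y All.∷ _) ∷ _) all≡z =
    contradiction (trans (all≡z (here refl)) (≡.sym (all≡z (there (here refl))))) x≢y

module _ {A : Set} (f : A → Bool) where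

  sum-indicator≤length-filter : ∀ {P : Pred A 0ℓ} (P? : Decidable P) → (∀ x → T (f x) → P x) →
    ∀ xs → sum (map (λ x → if f x then 1 else 0) xs) ≤ length (filter P? xs)
  sum-indicator≤length-filter P? f⇒P [] = z≤n
  sum-indicator≤length-filter P? f⇒P (x ∷ xs) with f x in fx | P? x
  ... | true | yes _ = s≤s (sum-indicator≤length-filter P? f⇒P xs)
  ... | true | no ¬Px = contradiction (f⇒P x (subst T (≡.sym fx) tt)) ¬Px
  ... | false | yes _ = m≤n⇒m≤1+n (sum-indicator≤length-filter P? f⇒P xs)
  ... | false | no _ = sum-indicator≤length-filter P? f⇒P xs

  1≤sum-indicator : ∀ {x xs} → x ∈ xs → T (f x) → 1 ≤ sum (map (λ x → if f x then 1 else 0) xs)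
  1≤sum-indicator {x} (here refl) fx with f x
  ... | true = s≤s z≤n
  1≤sum-indicator {xs = y ∷ _} (there x∈) fx = ≤-trans (1≤sum-indicator x∈ fx) (m≤n+m _ _)

sum-map-≤ : ∀ {A : Set} {D} (g : A → ℕ) → (∀ x → g x ≤ D) → ∀ xs → sum (map g xs) ≤ length xs * D
sum-map-≤ g g≤D [] = z≤n
sum-map-≤ g g≤D (x ∷ xs) = +-mono-≤ (g≤D x) (sum-map-≤ g g≤D xs)

≤-sum-tabulate : ∀ {n k} (g : Fin n → ℕ) → k ≤ n → (∀ i → toℕ i < k → 1 ≤ g i) → k ≤ sum (tabulate g)
≤-sum-tabulate {k = zero} g _ _ = z≤n
≤-sum-tabulate {suc n} {suc k} g (s≤s k≤n) g≥1 =
  +-mono-≤ (g≥1 zero (s≤s z≤n)) (≤-sum-tabulate (g ∘ suc) k≤n (λ i i<k → g≥1 (suc i) (s≤s i<k)))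

T-if-then-not⇒≡ : ∀ b x → T (if b then x else not x) → x ≡ b
T-if-then-not⇒≡ true true _ = refl
T-if-then-not⇒≡ false false _ = refl

≡⇒T-if-then-not : ∀ b x → x ≡ b → T (if b then x else not x)
≡⇒T-if-then-not true true _ = tt
≡⇒T-if-then-not false false _ = tt

ramseyBound : ℕ → ℕ → ℕ
ramseyBound zero q = 0
ramseyBound (suc p) zero = 0
ramseyBound (suc p) (suc q) = suc (ramseyBound p (suc q) + ramseyBound (suc p) q)

starRamsey : ℕ → ℕ
starRamsey t = ramseyBound (suc (t * t)) t + ramseyBound t t

module _ {n} (c : Coloring n) where

  MonoClique : Bool → ∀ {k} → (Fin k → Fin n) → Set
  MonoClique b f = Injective _≡_ _≡_ f × ∀ i j → i ≢ j → col c (f i) (f j) ≡ b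

  CliqueIn : Bool → ℕ → List (Fin n) → Set
  CliqueIn b k S = Σ (Fin k → Fin n) λ f → MonoClique b f × ∀ i → f i ∈ S

  cliqueIn-mono : ∀ {b k S S′} → (∀ {y} → y ∈ S → y ∈ S′) → CliqueIn b k S → CliqueIn b k S′
  cliqueIn-mono S⊆S′ (f , clique , f∈S) = f , clique , S⊆S′ ∘ f∈S

  cliqueIn-extend : ∀ {b k x S S′} → x ∉ S → (∀ {y} → y ∈ S′ → y ∈ S × col c x y ≡ b) →
    CliqueIn b k S′ → CliqueIn b (suc k) (x ∷ S)
  cliqueIn-extend {b} {x = x} {S} x∉S nbr (f , (inj , mono) , f∈S′) = x ∷ᵛ f , (inj′ , mono′) , mem
    where
      f∈S : ∀ i → f i ∈ S
      f∈S = proj₁ ∘ nbr ∘ f∈S′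
      inj′ : Injective _≡_ _≡_ (x ∷ᵛ f)
      inj′ {zero} {zero} _ = refl
      inj′ {zero} {suc j} e = contradiction (subst (_∈ S) (≡.sym e) (f∈S j)) x∉S
      inj′ {suc i} {zero} e = contradiction (subst (_∈ S) e (f∈S i)) x∉S
      inj′ {suc i} {suc j} e = cong suc (inj e)
      mono′ : ∀ i j → i ≢ j → col c ((x ∷ᵛ f) i) ((x ∷ᵛ f) j) ≡ b
      mono′ zero zero 0≢0 = contradiction refl 0≢0
      mono′ zero (suc j) _ = proj₂ (nbr (f∈S′ j))
      mono′ (suc i) zero _ = trans (Coloring.sym c (f i) x) (proj₂ (nbr (f∈S′ i)))
      mono′ (suc i) (suc j) i≢j = mono i j (i≢j ∘ cong suc)
      mem : ∀ i → (x ∷ᵛ f) i ∈ x ∷ S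
      mem zero = here refl
      mem (suc i) = there (f∈S i)

  joined? : (b : Bool) (x : Fin n) → Decidable (λ y → col c x y ≡ b)
  joined? b x y = col c x y ≟ᵇ b

  ramsey : ∀ p q S → Unique S → ramseyBound p q ≤ length S → CliqueIn true p S ⊎ CliqueIn false q S
  ramsey zero q S _ _ = inj₁ ((λ ()) , ((λ { {()} }) , λ ()) , λ ())
  ramsey (suc p) zero S _ _ = inj₂ ((λ ()) , ((λ { {()} }) , λ ()) , λ ())
  ramsey (suc p) (suc q) (x ∷ S) u@(_ ∷ uS) (s≤s bound) =
    split (ramseyBound p (suc q) ≤? length red)
    where
      red? = joined? true x
      blue? = ∁? red?
      red = filter red? S
      blue = filter blue? S
      x∉S = Unique[x∷xs]⇒x∉xs u
      split : Dec (ramseyBound p (suc q) ≤ length red) →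
        CliqueIn true (suc p) (x ∷ S) ⊎ CliqueIn false (suc q) (x ∷ S)
      split (yes manyRed) =
        [ inj₁ ∘ cliqueIn-extend x∉S (∈-filter⁻ red?)
        , inj₂ ∘ cliqueIn-mono (there ∘ proj₁ ∘ ∈-filter⁻ red?) ]′
        (ramsey p (suc q) red (filter⁺ red? uS) manyRed)
      split (no fewRed) =
        [ inj₁ ∘ cliqueIn-mono (there ∘ proj₁ ∘ ∈-filter⁻ blue?)
        , inj₂ ∘ cliqueIn-extend x∉S (map₂ ¬-not ∘ ∈-filter⁻ blue?) ]′
        (ramsey (suc p) q blue (filter⁺ blue? uS) manyBlue)
        where
          manyBlue : ramseyBound (suc p) q ≤ length blue
          manyBlue = +-cancelˡ-≤ (length red) _ _ (≤-trans (+-monoˡ-≤ _ (<⇒≤ (≰⇒> fewRed)))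
            (≤-trans bound (≤-reflexive (≡.sym (length-filter-∁ red? S)))))

  nbr? : (b : Bool) (v : Fin n) → Decidable (λ w → v ≢ w × col c v w ≡ b)
  nbr? b v w = ¬? (v ≟ᶠ w) ×-dec joined? b v w

  nbrs : Bool → Fin n → List (Fin n)
  nbrs b v = filter (nbr? b v) (allFin n)

  nbrs-unique : ∀ b v → Unique (nbrs b v)
  nbrs-unique b v = filter⁺ _ (allFin⁺ n)

  cliqueIn-nbrs⇒inducedStar : ∀ {t b v} → CliqueIn (not b) t (nbrs b v) → InducedStarIn t c b
  cliqueIn-nbrs⇒inducedStar {b = b} {v} (f , (inj , mono) , f∈nbrs) =
    v , f , inj , (λ k e → proj₁ (joinedAt k) (≡.sym e)) , proj₂ ∘ joinedAt , mono
    where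
      joinedAt : ∀ k → v ≢ f k × col c v (f k) ≡ b
      joinedAt k = proj₂ (∈-filter⁻ (nbr? b v) {xs = allFin n} (f∈nbrs k))

  NonRedTo : ∀ {s} → (Fin s → Fin n) → Fin n → Fin s → Set
  NonRedTo f u k = f k ≡ u ⊎ col c (f k) u ≡ false

  nonRedTo? : ∀ {s} (f : Fin s → Fin n) u → Decidable (NonRedTo f u)
  nonRedTo? f u k = (f k ≟ᶠ u) ⊎-dec joined? false (f k) u

  redClique-nonRedTo-member : ∀ {s} {f : Fin s → Fin n} {k₀ u} → MonoClique true f → f k₀ ≡ u →
    length (filter (nonRedTo? f u) (allFin s)) ≤ 1
  redClique-nonRedTo-member {s} {f} {k₀} {u} (inj , red) fk₀≡u =
    length≤1 (filter⁺ _ (allFin⁺ s)) only-k₀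
    where
      only-k₀ : ∀ {k} → k ∈ filter (nonRedTo? f u) (allFin s) → k ≡ k₀
      only-k₀ {k} k∈ with k ≟ᶠ k₀ | proj₂ (∈-filter⁻ (nonRedTo? f u) {xs = allFin s} k∈)
      ... | yes k≡k₀ | _ = k≡k₀
      ... | no _ | inj₁ fk≡u = inj (trans fk≡u (≡.sym fk₀≡u))
      ... | no k≢k₀ | inj₂ blue =
        contradiction (trans (≡.sym (red k k₀ k≢k₀)) (trans (cong (col c (f k)) fk₀≡u) blue)) λ ()

  module NoInducedStar {t} (1≤t : 1 ≤ t) (noStar : ¬ HasInducedMonoStar t c) where

    redClique-nonRedTo-outsider : ∀ {s} {f : Fin s → Fin n} {u} → MonoClique true f →
      (∀ k → f k ≢ u) → length (filter (nonRedTo? f u) (allFin s)) ≤ t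
    redClique-nonRedTo-outsider {s} {f} {u} (inj , red) u∉f
      with t ≤? length (filter (nonRedTo? f u) (allFin s))
    ... | no fewer = <⇒≤ (≰⇒> fewer)
    ... | yes enough with h , h-inj , h∈ ← select (filter⁺ (nonRedTo? f u) (allFin⁺ s)) enough =
      contradiction (inj₂ blueStar) noStar
      where
        blue : ∀ i → col c (f (h i)) u ≡ false
        blue i with proj₂ (∈-filter⁻ (nonRedTo? f u) {xs = allFin s} (h∈ i))
        ... | inj₁ fhi≡u = contradiction fhi≡u (u∉f (h i))
        ... | inj₂ isBlue = isBlue
        blueStar : InducedStarIn t c false
        blueStar = u , f ∘ h , (λ e → h-inj (inj e)) , u∉f ∘ h ,
          (λ k → trans (Coloring.sym c u (f (h k))) (blue k)) ,
          (λ k l k≢l → red (h k) (h l) (k≢l ∘ h-inj))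

    redClique-fewNonRedTo : ∀ {s} {f : Fin s → Fin n} → MonoClique true f → ∀ u →
      length (filter (nonRedTo? f u) (allFin s)) ≤ t
    redClique-fewNonRedTo {f = f} redClique u with any? (λ k → f k ≟ᶠ u)
    ... | yes (_ , fk₀≡u) = ≤-trans (redClique-nonRedTo-member redClique fk₀≡u) 1≤t
    ... | no u∉f = redClique-nonRedTo-outsider redClique (λ k → u∉f ∘ (k ,_))

    redClique-blueClique-⊥ : ∀ {f : Fin (suc (t * t)) → Fin n} {g : Fin t → Fin n} →
      MonoClique true f → MonoClique false g → ⊥
    redClique-blueClique-⊥ {f} {g} redClique (g-inj , blue)
      with k , _ , redToAll ← pigeonhole-avoid t (NonRedTo f ∘ g) (nonRedTo? f ∘ g) (allFin (suc (t * t)))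
             (redClique-fewNonRedTo redClique ∘ g)
             (≤-reflexive (≡.sym (length-tabulate (λ i → i))))
      = noStar (inj₁ (f k , g , g-inj , (λ i e → redToAll i (inj₁ (≡.sym e))) ,
                      (λ i → ¬-not (redToAll i ∘ inj₂)) , blue))

    sparseColor : ∃ λ b → ∀ v → length (nbrs b v) ≤ starRamsey t
    sparseColor with any? (λ v → ramseyBound (suc (t * t)) t <? length (nbrs true v))
    ... | no allSmall = true , λ v → ≤-trans (≮⇒≥ (allSmall ∘ (v ,_))) (m≤m+n _ _)
    ... | yes (v , big) with ramsey (suc (t * t)) t (nbrs true v) (nbrs-unique true v) (<⇒≤ big)
    ...   | inj₂ blueInRed = contradiction (inj₁ (cliqueIn-nbrs⇒inducedStar blueInRed)) noStar
    ...   | inj₁ (f , redClique , _) = false , λ w → ≤-trans (≮⇒≥ λ big′ →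
      [ (λ redInBlue → noStar (inj₂ (cliqueIn-nbrs⇒inducedStar redInBlue))) ,
        (λ (g , blueClique , _) → redClique-blueClique-⊥ redClique blueClique) ]′
      (ramsey t t (nbrs false w) (nbrs-unique false w) (<⇒≤ big′))) (m≤n+m _ _)

module _ {n} (c : Coloring n) (b : Bool) where

  private
    counted : Fin n → Fin n → Bool
    counted i j = (toℕ i <ᵇ toℕ j) ∧ (if b then col c i j else not (col c i j))

    row : Fin n → ℕ
    row i = sum (map (λ j → if counted i j then 1 else 0) (allFin n))

  countColor≤ : ∀ D → (∀ v → length (nbrs c b v) ≤ D) → countColor c b ≤ n * D
  countColor≤ D small = ≤-trans
    (sum-map-≤ row (λ i → ≤-trans (row≤nbrs i) (small i)) (allFin n))
    (≤-reflexive (cong (_* D) (length-tabulate {n = n} id)))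
    where
      counted⇒nbr : ∀ i j → T (counted i j) → i ≢ j × col c i j ≡ b
      counted⇒nbr i j e with i<j , agree ← Equivalence.to T-∧ e =
        (λ { refl → <⇒≢ (<ᵇ⇒< (toℕ i) (toℕ j) i<j) refl }) , T-if-then-not⇒≡ b _ agree
      row≤nbrs : ∀ i → row i ≤ length (nbrs c b i)
      row≤nbrs i = sum-indicator≤length-filter (counted i) (nbr? c b i) (counted⇒nbr i) (allFin n)

  ≤-countColor : ∀ k → k ≤ n → (∀ i → toℕ i < k → ∃ λ j → toℕ i < toℕ j × col c i j ≡ b) →
    k ≤ countColor c b
  ≤-countColor k k≤n later =
    subst (k ≤_) (≡.sym (cong sum (map-tabulate id row))) (≤-sum-tabulate row k≤n row≥1)
    where
      row≥1 : ∀ i → toℕ i < k → 1 ≤ row i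
      row≥1 i i<k with j , i<j , cij ← later i i<k =
        1≤sum-indicator (counted i) (∈-allFin j)
          (Equivalence.from T-∧ (<⇒<ᵇ i<j , ≡⇒T-if-then-not b _ cij))

Adjacent : ℕ → ℕ → Set
Adjacent a b = suc a ≡ b ⊎ suc b ≡ a

adjacent? : ∀ a b → Dec (Adjacent a b)
adjacent? a b = (suc a ≟ⁿ b) ⊎-dec (suc b ≟ⁿ a)

adjacent-three : ∀ {a x y z} → Adjacent a x → Adjacent a y → Adjacent a z →
  x ≢ y → x ≢ z → y ≢ z → ⊥
adjacent-three (inj₁ refl) (inj₁ refl) _ x≢y _ _ = x≢y refl
adjacent-three (inj₂ refl) (inj₂ refl) _ x≢y _ _ = x≢y refl
adjacent-three (inj₁ refl) (inj₂ refl) (inj₁ refl) _ x≢z _ = x≢z refl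
adjacent-three (inj₁ refl) (inj₂ refl) (inj₂ refl) _ _ y≢z = y≢z refl
adjacent-three (inj₂ refl) (inj₁ refl) (inj₁ refl) _ _ y≢z = y≢z refl
adjacent-three (inj₂ refl) (inj₁ refl) (inj₂ refl) _ x≢z _ = x≢z refl

adjacent-triangle-free : ∀ {x y z} → Adjacent x y → Adjacent x z → ¬ Adjacent y z
adjacent-triangle-free (inj₁ refl) (inj₁ refl) (inj₁ ())
adjacent-triangle-free (inj₁ refl) (inj₁ refl) (inj₂ ())
adjacent-triangle-free (inj₁ refl) (inj₂ refl) (inj₁ ())
adjacent-triangle-free (inj₁ refl) (inj₂ refl) (inj₂ ())
adjacent-triangle-free (inj₂ refl) (inj₁ refl) (inj₁ ())
adjacent-triangle-free (inj₂ refl) (inj₁ refl) (inj₂ ())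
adjacent-triangle-free (inj₂ refl) (inj₂ refl) (inj₁ ())
adjacent-triangle-free (inj₂ refl) (inj₂ refl) (inj₂ ())

path : ∀ n → Coloring n
path n = record
  { col = λ i j → does (adjacent? (toℕ i) (toℕ j))
  ; sym = λ i j → ∨-comm (does (suc (toℕ i) ≟ⁿ toℕ j)) (does (suc (toℕ j) ≟ⁿ toℕ i))
  }

path-red⇒adjacent : ∀ {n} (i j : Fin n) → col (path n) i j ≡ true → Adjacent (toℕ i) (toℕ j)
path-red⇒adjacent i j red = invert (subst (Reflects _) red (proof (adjacent? (toℕ i) (toℕ j))))

path-noInducedMonoStar : ∀ {t} n → 3 ≤ t → ¬ HasInducedMonoStar t (path n)
path-noInducedMonoStar n (s≤s (s≤s (s≤s _))) (inj₁ (v , f , f-inj , _ , red , _)) =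
  adjacent-three (centre (# 0)) (centre (# 1)) (centre (# 2))
    (distinct (# 0) (# 1) λ ()) (distinct (# 0) (# 2) λ ()) (distinct (# 1) (# 2) λ ())
  where
    distinct : ∀ k l → k ≢ l → toℕ (f k) ≢ toℕ (f l)
    distinct k l k≢l = k≢l ∘ f-inj ∘ toℕ-injective
    centre : ∀ k → Adjacent (toℕ v) (toℕ (f k))
    centre k = path-red⇒adjacent v (f k) (red k)
path-noInducedMonoStar n (s≤s (s≤s (s≤s _))) (inj₂ (_ , f , _ , _ , _ , leaves)) =
  adjacent-triangle-free (leaf (# 0) (# 1) λ ()) (leaf (# 0) (# 2) λ ()) (leaf (# 1) (# 2) λ ())
  where
    leaf : ∀ k l → k ≢ l → Adjacent (toℕ (f k)) (toℕ (f l))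
    leaf k l k≢l = path-red⇒adjacent (f k) (f l) (leaves k l k≢l)

adjacent-2⊥ : ∀ a → ¬ Adjacent a (2 + a)
adjacent-2⊥ a (inj₁ ())
adjacent-2⊥ a (inj₂ ())

module _ {n} (k : ℕ) (k+2≤n : 2 + k ≤ n) where

  private
    k≤n : k ≤ n
    k≤n = ≤-trans (m≤n+m k 2) k+2≤n

    shift : ∀ {i} d → d ≤ 2 → i < k → d + i < n
    shift d d≤2 i<k = <-≤-trans (+-monoʳ-< d i<k) (≤-trans (+-monoˡ-≤ k d≤2) k+2≤n)

    path-col-fromℕ< : ∀ (i : Fin n) {d} .(d+i<n : d + toℕ i < n) →
      col (path n) i (fromℕ< d+i<n) ≡ does (adjacent? (toℕ i) (d + toℕ i))
    path-col-fromℕ< i d+i<n = cong (does ∘ adjacent? (toℕ i)) (toℕ-fromℕ< d+i<n)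

  path-redCount-≥ : k ≤ redCount (path n)
  path-redCount-≥ = ≤-countColor (path n) true k k≤n λ i i<k →
    let 1+i<n = shift 1 (s≤s z≤n) i<k in
    fromℕ< 1+i<n , subst (toℕ i <_) (≡.sym (toℕ-fromℕ< 1+i<n)) (n<1+n _) ,
    ≡.trans (path-col-fromℕ< i 1+i<n) (dec-true (adjacent? (toℕ i) (1 + toℕ i)) (inj₁ refl))

  path-blueCount-≥ : k ≤ blueCount (path n)
  path-blueCount-≥ = ≤-countColor (path n) false k k≤n λ i i<k →
    let 2+i<n = shift 2 ≤-refl i<k in
    fromℕ< 2+i<n , subst (toℕ i <_) (≡.sym (toℕ-fromℕ< 2+i<n)) (m<n+m _ (s≤s z≤n)) ,
    ≡.trans (path-col-fromℕ< i 2+i<n)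
      (dec-false (adjacent? (toℕ i) (2 + toℕ i)) (adjacent-2⊥ (toℕ i)))

forces-linear : ∀ {t} → 1 ≤ t → ∀ n → Forces t n (starRamsey t * n)
forces-linear {t} 1≤t n c manyRed manyBlue with hasInducedMonoStar? t c
... | yes star = star
... | no noStar with b , sparse ← NoInducedStar.sparseColor c 1≤t noStar =
  contradiction
    (<-≤-trans (many b) (≤-trans (countColor≤ c b _ sparse) (≤-reflexive (*-comm n _))))
    (n≮n _)
  where
    many : ∀ b → starRamsey t * n < countColor c b
    many true = manyRed
    many false = manyBlue

starFree⇒≤-forced : ∀ {t n m k} (c : Coloring n) → ¬ HasInducedMonoStar t c →
  k ≤ redCount c → k ≤ blueCount c → Forces t n m → k ≤ m
starFree⇒≤-forced c noStar k≤red k≤blue forces =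
  ≮⇒≥ λ m<k → noStar (forces c (<-≤-trans m<k k≤red) (<-≤-trans m<k k≤blue))

starRamsey-positive : ∀ {t} → 1 ≤ t → starRamsey t > 0
starRamsey-positive {suc t} _ = s≤s z≤n

corollary2p5 : ∀ (t : ℕ) → t ≥ 3 →
    Σ ℕ λ c → Σ ℕ λ C → Σ ℕ λ N → c > 0 × C > 0 ×
      (∀ n → n ≥ N → Σ ℕ λ m → IsEx2Star t n m × n ≤ c * m × m ≤ C * n)
corollary2p5 t t≥3 = 3 , starRamsey t , 3 , s≤s z≤n , starRamsey-positive 1≤t , ex₂-bounds
  where
    1≤t : 1 ≤ t
    1≤t = ≤-trans (s≤s z≤n) t≥3
    ex₂-bounds : ∀ n → n ≥ 3 → Σ ℕ λ m → IsEx2Star t n m × n ≤ 3 * m × m ≤ starRamsey t * n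
    ex₂-bounds n@(suc (suc (suc k))) (s≤s (s≤s (s≤s _))) =
      let m , forces , minimal , m≤Kn = least-witness (Forces t n) (forces? t n) (forces-linear 1≤t n)
          1+k≤m = starFree⇒≤-forced (path n) (path-noInducedMonoStar n t≥3)
            (path-redCount-≥ (suc k) ≤-refl) (path-blueCount-≥ (suc k) ≤-refl) forces
      in m , (forces , minimal) , 3+k≤3*m 1+k≤m , m≤Kn
      where
        3+k≤3*m : ∀ {m} → suc k ≤ m → 3 + k ≤ 3 * m
        3+k≤3*m 1+k≤m = ≤-trans (≤-reflexive (+-comm 2 (suc k)))
          (+-mono-≤ 1+k≤m (*-monoʳ-≤ 2 (≤-trans (s≤s z≤n) 1+k≤m)))
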